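{- Let $y_1=(y_{11},\dots,y_{m1})^t\in\mathbb{Z}^m$ and let $X$ be the standardized abelian Cayley graph with Heuberger matrix the $m\times 1$ matrix $(y_1)$. If $y_1=\pm e_j$ for some $j$, then $X$ has loops and hence cannot be properly colored. Otherwise, $\chi(X)=2$ if $y_1$ has an even number of odd entries, and $\chi(X)=3$ if $y_1$ has an odd number of odd entries.
   Context: Given an $m\times r$ integer matrix $M$, let $H$ be the subgroup of $\mathbb{Z}^m$ generated by the columns of $M$, let $e_1,\dots,e_m$ be the standard basis of $\mathbb{Z}^m$, and $S=\{H\pm e_1,\dots,H\pm e_m\}$. The standardized abelian Cayley graph with Heuberger matrix $M$ is $\mathrm{Cay}(\mathbb{Z}^m/H,S)$ (vertices $\mathbb{Z}^m/H$, $x\sim y$ iff $x-y\in S$; loops allowed, no multiple edges). $\chi$ denotes chromatic number. -}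

module Defs where

open import Data.Nat as ℕ using (ℕ; zero; suc; _<_; _%_)
open import Data.Integer as ℤ using (ℤ; ∣_∣; 0ℤ; 1ℤ)
open import Data.Fin using (Fin)
open import Data.Vec using (Vec; []; _∷_; zipWith; map; replicate; updateAt)
open import Data.Product using (Σ; _×_; ∃)
open import Data.Sum using (_⊎_)
open import Relation.Binary.PropositionalEquality using (_≡_; _≢_)
open import Relation.Nullary using (¬_)

-- Elements of ℤ^m (as data vectors, so ≡ is structural equality)
ℤ^ : ℕ → Set
ℤ^ m = Vec ℤ m

_⊕_ : {m : ℕ} → ℤ^ m → ℤ^ m → ℤ^ m
_⊕_ = zipWith ℤ._+_

_⊖_ : {m : ℕ} → ℤ^ m → ℤ^ m → ℤ^ m
_⊖_ = zipWith ℤ._-_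

_·_ : {m : ℕ} → ℤ → ℤ^ m → ℤ^ m
t · v = map (t ℤ.*_) v

neg : {m : ℕ} → ℤ^ m → ℤ^ m
neg = map (λ z → ℤ.- z)

e : {m : ℕ} → Fin m → ℤ^ m
e i = updateAt (replicate _ 0ℤ) i (λ _ → 1ℤ)

-- Cayley graph Cay(ℤ^m / H, S) with H = ℤ y (Heuberger matrix the m×1 matrix (y)),
-- presented on representatives in ℤ^m.
-- Adjacency of cosets a+H and b+H:  a - b ∈ H ± e_i for some i.
Adj : {m : ℕ} → ℤ^ m → ℤ^ m → ℤ^ m → Set
Adj {m} y a b =
  Σ (Fin m) λ i → Σ ℤ λ t →
    ((a ⊖ b) ≡ ((t · y) ⊕ e i)) ⊎ ((a ⊖ b) ≡ ((t · y) ⊖ e i))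

HasLoop : {m : ℕ} → ℤ^ m → Set
HasLoop {m} y = Σ (ℤ^ m) λ a → Adj y a a

-- a k-colouring of the vertex set ℤ^m / H: a colouring of ℤ^m constant on cosets of H
WellDefined : {m k : ℕ} → ℤ^ m → (ℤ^ m → Fin k) → Set
WellDefined {m} y c = (a : ℤ^ m) (t : ℤ) → c (a ⊕ (t · y)) ≡ c a

Proper : {m k : ℕ} → ℤ^ m → (ℤ^ m → Fin k) → Set
Proper {m} y c = (a b : ℤ^ m) → Adj y a b → c a ≢ c b

Colorable : {m : ℕ} → ℤ^ m → ℕ → Set
Colorable {m} y k = Σ (ℤ^ m → Fin k) λ c → WellDefined y c × Proper y c

ChromaticNumber : {m : ℕ} → ℤ^ m → ℕ → Set
ChromaticNumber y k = Colorable y k × ((k' : ℕ) → k' < k → ¬ Colorable y k')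

countOdd : {m : ℕ} → ℤ^ m → ℕ
countOdd [] = 0
countOdd (z ∷ v) with ∣ z ∣ % 2
... | 0 = countOdd v
... | _ = suc (countOdd v)

IsPlusMinusBasis : {m : ℕ} → ℤ^ m → Set
IsPlusMinusBasis {m} y = Σ (Fin m) λ j → (y ≡ e j) ⊎ (y ≡ neg (e j))

-- Let s be the sign vector of y, so that s · y = ‖y‖₁, and colour v ∈ ℤᵐ by the residue of s · v
-- modulo N through a proper colouring of the N-cycle. Each generator ±eᵢ changes s · v by ±1 and,
-- when N ∣ ‖y‖₁, each element of H = ℤy changes it by a multiple of N. So N = 2 gives a
-- 2-colouring when ‖y‖₁ is even, and N = ‖y‖₁ (≥ 3, as y ≠ ±eⱼ) a 3-colouring otherwise.
-- Conversely, a proper 2-colouring swaps colours along every edge, and 0 and y are the same vertex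
-- yet joined by a walk of length ‖y‖₁, so ‖y‖₁ is even. Finally ‖y‖₁ has the parity of the number
-- of odd entries of y.
module Submission where

open import Defs
open import Data.Nat using (ℕ; _≤_; _%_)
open import Data.Product using (_×_)
open import Relation.Binary.PropositionalEquality using (_≡_)
open import Relation.Nullary using (¬_)

open import Data.Nat as ℕ using (zero; suc; NonZero; _<_; _/_; z≤n; s≤s)
import Data.Nat.Properties as ℕP
open import Data.Nat.DivMod
  using (m<n⇒m%n≡m; n%n≡0; m≡m%n+[m/n]*n; m%n<n; %-distribˡ-+; m%n%n≡m%n; [m+kn]%n≡m%n)
open import Data.Nat.Divisibility using (_∣_; divides; m%n≡0⇒n∣m; ∣-refl)
open import Data.Integer using (ℤ; +_; -[1+_]; ∣_∣; 0ℤ; 1ℤ; -1ℤ; _+_; _-_; _*_; -_)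
import Data.Integer.Properties as ℤP
open import Data.Integer.DivMod using (_%ℕ_; _/ℕ_; n%ℕd<d; a≡a%ℕn+[a/ℕn]*n)
open import Data.Integer.Tactic.RingSolver using (solve-∀)
open import Data.Fin using (Fin; zero; suc; fromℕ; inject₁; inject≤)
open import Data.Fin.Properties using (fromℕ≢inject₁; inject₁-injective; inject≤-injective)
open import Data.Vec using ([]; _∷_; map; replicate; lookup)
open import Data.Vec.Properties using (lookup-map; map-cong; map-id; zipWith-replicate₂)
open import Data.Product using (_,_)
open import Data.Sum using (_⊎_; inj₁; inj₂)
open import Data.Empty using (⊥-elim)
open import Relation.Binary.PropositionalEquality
  using (_≢_; refl; sym; trans; cong; cong₂; module ≡-Reasoning)

private
  variable
    m : ℕ

dot : ℤ^ m → ℤ^ m → ℤ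
dot [] [] = 0ℤ
dot (s ∷ ss) (x ∷ xs) = s * x + dot ss xs

dot-⊕ : (s u v : ℤ^ m) → dot s (u ⊕ v) ≡ dot s u + dot s v
dot-⊕ [] [] [] = refl
dot-⊕ (s ∷ ss) (u ∷ us) (v ∷ vs) rewrite dot-⊕ ss us vs = distrib s u v (dot ss us) (dot ss vs)
  where
  distrib : ∀ s u v a b → s * (u + v) + (a + b) ≡ (s * u + a) + (s * v + b)
  distrib = solve-∀

dot-⊖ : (s u v : ℤ^ m) → dot s (u ⊖ v) ≡ dot s u - dot s v
dot-⊖ [] [] [] = refl
dot-⊖ (s ∷ ss) (u ∷ us) (v ∷ vs) rewrite dot-⊖ ss us vs = distrib s u v (dot ss us) (dot ss vs)
  where
  distrib : ∀ s u v a b → s * (u - v) + (a - b) ≡ (s * u + a) - (s * v + b)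
  distrib = solve-∀

dot-· : (s : ℤ^ m) (t : ℤ) (v : ℤ^ m) → dot s (t · v) ≡ t * dot s v
dot-· [] t [] = sym (ℤP.*-zeroʳ t)
dot-· (s ∷ ss) t (v ∷ vs) rewrite dot-· ss t vs = distrib s t v (dot ss vs)
  where
  distrib : ∀ s t v a → s * (t * v) + t * a ≡ t * (s * v + a)
  distrib = solve-∀

dot-zeroʳ : (s : ℤ^ m) → dot s (replicate m 0ℤ) ≡ 0ℤ
dot-zeroʳ [] = refl
dot-zeroʳ (s ∷ ss) rewrite dot-zeroʳ ss | ℤP.*-zeroʳ s = refl

dot-e : (s : ℤ^ m) (i : Fin m) → dot s (e i) ≡ lookup s i
dot-e (s ∷ ss) zero rewrite dot-zeroʳ ss = trans (ℤP.+-identityʳ _) (ℤP.*-identityʳ s)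
dot-e (s ∷ ss) (suc i) rewrite ℤP.*-zeroʳ s = trans (ℤP.+-identityˡ _) (dot-e ss i)

⊕-identityʳ : (v : ℤ^ m) → v ⊕ replicate m 0ℤ ≡ v
⊕-identityʳ v = trans (zipWith-replicate₂ _+_ v 0ℤ) (trans (map-cong ℤP.+-identityʳ v) (map-id v))

·-identityˡ : (v : ℤ^ m) → 1ℤ · v ≡ v
·-identityˡ v = trans (map-cong ℤP.*-identityˡ v) (map-id v)

[b⊕u]⊖b≡0·v⊕u : (b u v : ℤ^ m) → (b ⊕ u) ⊖ b ≡ (0ℤ · v) ⊕ u
[b⊕u]⊖b≡0·v⊕u [] [] [] = refl
[b⊕u]⊖b≡0·v⊕u (b ∷ bs) (u ∷ us) (v ∷ vs) =
  cong₂ _∷_ (cancel b u v) ([b⊕u]⊖b≡0·v⊕u bs us vs)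
  where
  cancel : ∀ b u v → (b + u) - b ≡ 0ℤ * v + u
  cancel = solve-∀

a⊖a≡-1·v⊕v : (a v : ℤ^ m) → a ⊖ a ≡ (-1ℤ · v) ⊕ v
a⊖a≡-1·v⊕v [] [] = refl
a⊖a≡-1·v⊕v (a ∷ as) (v ∷ vs) = cong₂ _∷_ (cancel a v) (a⊖a≡-1·v⊕v as vs)
  where
  cancel : ∀ a v → a - a ≡ -1ℤ * v + v
  cancel = solve-∀

a⊖a≡1·[-v]⊕v : (a v : ℤ^ m) → a ⊖ a ≡ (1ℤ · neg v) ⊕ v
a⊖a≡1·[-v]⊕v [] [] = refl
a⊖a≡1·[-v]⊕v (a ∷ as) (v ∷ vs) = cong₂ _∷_ (cancel a v) (a⊖a≡1·[-v]⊕v as vs)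
  where
  cancel : ∀ a v → a - a ≡ 1ℤ * - v + v
  cancel = solve-∀

adjacent-e : (y b : ℤ^ m) (i : Fin m) → Adj y (b ⊕ e i) b
adjacent-e y b i = i , 0ℤ , inj₁ ([b⊕u]⊖b≡0·v⊕u b (e i) y)

±basis⇒loop : (y : ℤ^ m) → IsPlusMinusBasis y → HasLoop y
±basis⇒loop {m} y (j , inj₁ refl) = replicate m 0ℤ , j , -1ℤ , inj₁ (a⊖a≡-1·v⊕v _ _)
±basis⇒loop {m} y (j , inj₂ refl) = replicate m 0ℤ , j , 1ℤ , inj₁ (a⊖a≡1·[-v]⊕v _ _)

loop⇒¬colorable : ∀ {k} (y : ℤ^ m) → HasLoop y → ¬ Colorable y k
loop⇒¬colorable y (a , loop) (c , _ , proper) = proper a a loop refl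

colorable-mono : ∀ {k k'} (y : ℤ^ m) → k ≤ k' → Colorable y k → Colorable y k'
colorable-mono y k≤k' (c , well-defined , proper) =
  (λ v → inject≤ (c v) k≤k') ,
  (λ a t → cong (λ x → inject≤ x k≤k') (well-defined a t)) ,
  (λ a b adj same → proper a b adj (inject≤-injective k≤k' k≤k' _ _ same))

chromaticNumber : ∀ {k} (y : ℤ^ m) → Colorable y (suc k) → ¬ Colorable y k →
                  ChromaticNumber y (suc k)
chromaticNumber y colorable ¬colorable =
  colorable , λ k' k'<1+k colorable' → ¬colorable (colorable-mono y (ℕ.s≤s⁻¹ k'<1+k) colorable')

¬colorable₁ : (y : ℤ^ (suc m)) → ¬ Colorable y 1
¬colorable₁ {m} y (c , _ , proper) = proper (a ⊕ e zero) a (adjacent-e y a zero) (Fin1-unique _ _)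
  where
  a : ℤ^ (suc m)
  a = replicate (suc m) 0ℤ
  Fin1-unique : (i j : Fin 1) → i ≡ j
  Fin1-unique zero zero = refl

pos-+-* : ∀ a b c → + (a ℕ.+ b ℕ.* c) ≡ + a + + b * + c
pos-+-* a b c = trans (ℤP.pos-+ a (b ℕ.* c)) (cong (λ z → + a + z) (ℤP.pos-* b c))

module _ {n : ℕ} .{{_ : NonZero n}} where

  private
    residue-shift : ∀ {r r'} → r < n → r' < n → (d : ℤ) → + r ≡ + r' + d * + n → r ≡ r'
    residue-shift {r} {r'} r<n r'<n (+ k) eq = begin
      r                    ≡⟨ sym (m<n⇒m%n≡m r<n) ⟩
      r % n                ≡⟨ cong (_% n) (ℤP.+-injective (trans eq (sym (pos-+-* r' k n)))) ⟩
      (r' ℕ.+ k ℕ.* n) % n ≡⟨ [m+kn]%n≡m%n r' k n ⟩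
      r' % n               ≡⟨ m<n⇒m%n≡m r'<n ⟩
      r'                   ∎
      where open ≡-Reasoning
    residue-shift {r} {r'} r<n r'<n d@(-[1+ _ ]) eq =
      sym (residue-shift r'<n r<n (- d) (trans (cancel (+ r') d (+ n)) (cong (_+ - d * + n) (sym eq))))
      where
      cancel : ∀ a d n → a ≡ (a + d * n) + - d * n
      cancel = solve-∀

  residue-unique : ∀ {r r'} → r < n → r' < n → (q q' : ℤ) →
                   + r + q * + n ≡ + r' + q' * + n → r ≡ r'
  residue-unique {r} {r'} r<n r'<n q q' eq = residue-shift r<n r'<n (q' - q) (begin
    + r                       ≡⟨ cancel (+ r) q (+ n) ⟩
    + r + q * + n - q * + n   ≡⟨ cong (_- q * + n) eq ⟩
    + r' + q' * + n - q * + n ≡⟨ regroup (+ r') q q' (+ n) ⟩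
    + r' + (q' - q) * + n     ∎)
    where
    open ≡-Reasoning
    cancel : ∀ a q n → a ≡ (a + q * n) - q * n
    cancel = solve-∀
    regroup : ∀ a q q' n → (a + q' * n) - q * n ≡ a + (q' - q) * n
    regroup = solve-∀

  %ℕ-≡ : ∀ x r q → x ≡ + r + q * + n → x %ℕ n ≡ r % n
  %ℕ-≡ x r q eq = residue-unique (n%ℕd<d x n) (m%n<n r n) (x /ℕ n) (q + + (r / n)) (begin
    + (x %ℕ n) + (x /ℕ n) * + n          ≡⟨ sym (a≡a%ℕn+[a/ℕn]*n x n) ⟩
    x                                    ≡⟨ eq ⟩
    + r + q * + n                        ≡⟨ cong (λ a → + a + q * + n) (m≡m%n+[m/n]*n r n) ⟩
    + (r % n ℕ.+ r / n ℕ.* n) + q * + n  ≡⟨ cong (_+ q * + n) (pos-+-* (r % n) (r / n) n) ⟩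
    + (r % n) + + (r / n) * + n + q * + n ≡⟨ regroup (+ (r % n)) (+ (r / n)) q (+ n) ⟩
    + (r % n) + (q + + (r / n)) * + n    ∎)
    where
    open ≡-Reasoning
    regroup : ∀ a b q n → a + b * n + q * n ≡ a + (q + b) * n
    regroup = solve-∀

  [x+tn]%ℕn≡x%ℕn : ∀ x t → (x + t * + n) %ℕ n ≡ x %ℕ n
  [x+tn]%ℕn≡x%ℕn x t =
    trans (%ℕ-≡ (x + t * + n) (x %ℕ n) (x /ℕ n + t) x+tn≡) (m<n⇒m%n≡m (n%ℕd<d x n))
    where
    regroup : ∀ a q t n → a + q * n + t * n ≡ a + (q + t) * n
    regroup = solve-∀
    x+tn≡ : x + t * + n ≡ + (x %ℕ n) + (x /ℕ n + t) * + n
    x+tn≡ = trans (cong (_+ t * + n) (a≡a%ℕn+[a/ℕn]*n x n)) (regroup (+ (x %ℕ n)) (x /ℕ n) t (+ n))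

  [x+1]%ℕn≡[1+x%ℕn]%n : ∀ x → (x + 1ℤ) %ℕ n ≡ suc (x %ℕ n) % n
  [x+1]%ℕn≡[1+x%ℕn]%n x = %ℕ-≡ (x + 1ℤ) (suc (x %ℕ n)) (x /ℕ n) x+1≡
    where
    regroup : ∀ a q n → a + q * n + 1ℤ ≡ 1ℤ + a + q * n
    regroup = solve-∀
    x+1≡ : x + 1ℤ ≡ + suc (x %ℕ n) + (x /ℕ n) * + n
    x+1≡ = trans (cong (_+ 1ℤ) (a≡a%ℕn+[a/ℕn]*n x n)) (regroup (+ (x %ℕ n)) (x /ℕ n) (+ n))

-- Colourings pulled back from cycles

IsUnit : ℤ → Set
IsUnit σ = σ ≡ 1ℤ ⊎ σ ≡ -1ℤ

IsUnit-neg : ∀ {σ} → IsUnit σ → IsUnit (- σ)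
IsUnit-neg (inj₁ refl) = inj₂ refl
IsUnit-neg (inj₂ refl) = inj₁ refl

ProperCycleColouring : (N : ℕ) .{{_ : NonZero N}} {k : ℕ} → (ℕ → Fin k) → Set
ProperCycleColouring N col = ∀ j → j < N → col (suc j % N) ≢ col j

module CycleColouring {k : ℕ} (N : ℕ) .{{_ : NonZero N}} (col : ℕ → Fin k)
                      (proper : ProperCycleColouring N col) where

  colour : ℤ → Fin k
  colour x = col (x %ℕ N)

  colour-periodic : ∀ x t → colour (x + t * + N) ≡ colour x
  colour-periodic x t = cong col ([x+tn]%ℕn≡x%ℕn x t)

  colour-suc : ∀ x → colour (x + 1ℤ) ≢ colour x
  colour-suc x rewrite [x+1]%ℕn≡[1+x%ℕn]%n x = proper (x %ℕ N) (n%ℕd<d x N)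

  colour-unit-step : ∀ x x' T σ → IsUnit σ → x - x' ≡ T * + N + σ → colour x ≢ colour x'
  colour-unit-step x x' T σ (inj₁ refl) eq same = colour-suc x' (begin
    colour (x' + 1ℤ)             ≡⟨ sym (colour-periodic (x' + 1ℤ) T) ⟩
    colour (x' + 1ℤ + T * + N)   ≡⟨ cong colour (regroup x' T (+ N)) ⟩
    colour (x' + (T * + N + 1ℤ)) ≡⟨ cong (λ d → colour (x' + d)) (sym eq) ⟩
    colour (x' + (x - x'))       ≡⟨ cong colour (sym (x≡y+[x-y] x x')) ⟩
    colour x                     ≡⟨ same ⟩
    colour x'                    ∎)
    where
    open ≡-Reasoning
    regroup : ∀ x T n → x + 1ℤ + T * n ≡ x + (T * n + 1ℤ)
    regroup = solve-∀
    x≡y+[x-y] : ∀ x y → x ≡ y + (x - y)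
    x≡y+[x-y] = solve-∀
  colour-unit-step x x' T σ (inj₂ refl) eq same = colour-suc x (begin
    colour (x + 1ℤ)                 ≡⟨ sym (colour-periodic (x + 1ℤ) (- T)) ⟩
    colour (x + 1ℤ + - T * + N)     ≡⟨ cong colour (regroup x T (+ N)) ⟩
    colour (x - (T * + N + -1ℤ))    ≡⟨ cong (λ d → colour (x - d)) (sym eq) ⟩
    colour (x - (x - x'))           ≡⟨ cong colour (sym (y≡x-[x-y] x x')) ⟩
    colour x'                       ≡⟨ sym same ⟩
    colour x                        ∎)
    where
    open ≡-Reasoning
    regroup : ∀ x T n → x + 1ℤ + - T * n ≡ x - (T * n + -1ℤ)
    regroup = solve-∀
    y≡x-[x-y] : ∀ x y → y ≡ x - (x - y)
    y≡x-[x-y] = solve-∀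

colorable-viaCycle : {k : ℕ} (y s : ℤ^ m) → (∀ i → IsUnit (lookup s i)) →
                     (N : ℕ) .{{_ : NonZero N}} (q : ℤ) → dot s y ≡ q * + N →
                     (col : ℕ → Fin k) → ProperCycleColouring N col → Colorable y k
colorable-viaCycle y s units N q s·y≡qN col proper = c , well-defined , adjacent-differ
  where
  open CycleColouring N col proper
  open ≡-Reasoning

  c : ℤ^ _ → Fin _
  c v = colour (dot s v)

  dot-multiple : ∀ t → dot s (t · y) ≡ t * q * + N
  dot-multiple t = begin
    dot s (t · y)   ≡⟨ dot-· s t y ⟩
    t * dot s y     ≡⟨ cong (t *_) s·y≡qN ⟩
    t * (q * + N)   ≡⟨ sym (ℤP.*-assoc t q (+ N)) ⟩
    t * q * + N     ∎

  well-defined : WellDefined y c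
  well-defined a t = begin
    colour (dot s (a ⊕ (t · y)))      ≡⟨ cong colour (dot-⊕ s a (t · y)) ⟩
    colour (dot s a + dot s (t · y))  ≡⟨ cong (λ d → colour (dot s a + d)) (dot-multiple t) ⟩
    colour (dot s a + t * q * + N)    ≡⟨ colour-periodic (dot s a) (t * q) ⟩
    colour (dot s a)                  ∎

  adjacent-differ : Proper y c
  adjacent-differ a b (i , t , inj₁ eq) =
    colour-unit-step (dot s a) (dot s b) (t * q) (lookup s i) (units i) (begin
    dot s a - dot s b              ≡⟨ sym (dot-⊖ s a b) ⟩
    dot s (a ⊖ b)                  ≡⟨ cong (dot s) eq ⟩
    dot s ((t · y) ⊕ e i)          ≡⟨ dot-⊕ s (t · y) (e i) ⟩
    dot s (t · y) + dot s (e i)    ≡⟨ cong₂ _+_ (dot-multiple t) (dot-e s i) ⟩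
    t * q * + N + lookup s i       ∎)
  adjacent-differ a b (i , t , inj₂ eq) =
    colour-unit-step (dot s a) (dot s b) (t * q) (- lookup s i) (IsUnit-neg (units i)) (begin
    dot s a - dot s b              ≡⟨ sym (dot-⊖ s a b) ⟩
    dot s (a ⊖ b)                  ≡⟨ cong (dot s) eq ⟩
    dot s ((t · y) ⊖ e i)          ≡⟨ dot-⊖ s (t · y) (e i) ⟩
    dot s (t · y) - dot s (e i)    ≡⟨ cong₂ _-_ (dot-multiple t) (dot-e s i) ⟩
    t * q * + N - lookup s i       ∎)

‖_‖₁ : ℤ^ m → ℕ
‖ [] ‖₁ = 0
‖ z ∷ v ‖₁ = ∣ z ∣ ℕ.+ ‖ v ‖₁

-- sgn 0 = 1, so that every entry of the sign vector is a unit
sgn : ℤ → ℤ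
sgn (+ _) = 1ℤ
sgn -[1+ _ ] = -1ℤ

sgn-isUnit : ∀ z → IsUnit (sgn z)
sgn-isUnit (+ _) = inj₁ refl
sgn-isUnit -[1+ _ ] = inj₂ refl

sgn*z≡∣z∣ : ∀ z → sgn z * z ≡ + ∣ z ∣
sgn*z≡∣z∣ (+ n) = ℤP.*-identityˡ (+ n)
sgn*z≡∣z∣ -[1+ n ] = ℤP.-1*i≡-i -[1+ n ]

dot-sgn : (y : ℤ^ m) → dot (map sgn y) y ≡ + ‖ y ‖₁
dot-sgn [] = refl
dot-sgn (z ∷ v) rewrite dot-sgn v | sgn*z≡∣z∣ z = sym (ℤP.pos-+ ∣ z ∣ ‖ v ‖₁)

sgn-units : (y : ℤ^ m) → ∀ i → IsUnit (lookup (map sgn y) i)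
sgn-units y i rewrite lookup-map i sgn y = sgn-isUnit (lookup y i)

colorable-viaNorm : {k : ℕ} (y : ℤ^ m) (N : ℕ) .{{_ : NonZero N}} → N ∣ ‖ y ‖₁ →
                    (col : ℕ → Fin k) → ProperCycleColouring N col → Colorable y k
colorable-viaNorm y N (divides w ‖y‖₁≡wN) =
  colorable-viaCycle y (map sgn y) (sgn-units y) N (+ w)
    (trans (dot-sgn y) (trans (cong +_ ‖y‖₁≡wN) (ℤP.pos-* w N)))

flip : Fin 2 → Fin 2
flip zero = suc zero
flip (suc zero) = zero

flip-involutive : ∀ x → flip (flip x) ≡ x
flip-involutive zero = refl
flip-involutive (suc zero) = refl

flip≢ : ∀ x → flip x ≢ x
flip≢ zero ()
flip≢ (suc zero) ()

≢⇒≡flip : ∀ {x x'} → x ≢ x' → x' ≡ flip x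
≢⇒≡flip {zero} {zero} x≢x' = ⊥-elim (x≢x' refl)
≢⇒≡flip {zero} {suc zero} _ = refl
≢⇒≡flip {suc zero} {zero} _ = refl
≢⇒≡flip {suc zero} {suc zero} x≢x' = ⊥-elim (x≢x' refl)

parity : ℕ → Fin 2
parity zero = zero
parity (suc j) = flip (parity j)

parity-properOn2 : ProperCycleColouring 2 parity
parity-properOn2 zero _ ()
parity-properOn2 (suc zero) _ ()
parity-properOn2 (suc (suc _)) (s≤s (s≤s ()))

-- Only 0 gets the third colour, which makes the wrap-around edge (N − 1, 0) safe as soon as N ≥ 2.
colour₃ : ℕ → Fin 3
colour₃ zero = fromℕ 2
colour₃ (suc j) = inject₁ (parity j)

colour₃-suc : ∀ j → colour₃ (suc j) ≢ colour₃ j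
colour₃-suc zero ()
colour₃-suc (suc j) eq = flip≢ (parity j) (inject₁-injective eq)

colour₃-properOn : ∀ N .{{_ : NonZero N}} → 2 ≤ N → ProperCycleColouring N colour₃
colour₃-properOn N 2≤N j j<N same with ℕP.m≤n⇒m<n∨m≡n j<N
... | inj₁ 1+j<N = colour₃-suc j (trans (cong colour₃ (sym (m<n⇒m%n≡m 1+j<N))) same)
... | inj₂ 1+j≡N = wraps-around j 1+j≡N (trans (cong colour₃ (sym 1+j%N≡0)) same)
  where
  1+j%N≡0 : suc j % N ≡ 0
  1+j%N≡0 = trans (cong (_% N) 1+j≡N) (n%n≡0 N)
  wraps-around : ∀ j → suc j ≡ N → colour₃ 0 ≢ colour₃ j
  wraps-around zero 1≡N _ = ℕP.<⇒≢ 2≤N 1≡N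
  wraps-around (suc i) _ = fromℕ≢inject₁

colorable₂ : (y : ℤ^ m) → ‖ y ‖₁ % 2 ≡ 0 → Colorable y 2
colorable₂ y even = colorable-viaNorm y 2 (m%n≡0⇒n∣m ‖ y ‖₁ 2 even) parity parity-properOn2

colorable₃ : (y : ℤ^ m) → 2 ≤ ‖ y ‖₁ → Colorable y 3
colorable₃ y 2≤‖y‖₁ =
  colorable-viaNorm y ‖ y ‖₁ ∣-refl colour₃ (colour₃-properOn ‖ y ‖₁ 2≤‖y‖₁)
  where
  instance
    ‖y‖₁≢0 : NonZero ‖ y ‖₁
    ‖y‖₁≢0 = ℕ.>-nonZero (ℕP.<-trans ℕ.z<s 2≤‖y‖₁)

-- Walks and the odd obstruction

flip^ : ℕ → Fin 2 → Fin 2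
flip^ zero x = x
flip^ (suc n) x = flip (flip^ n x)

flip^-+ : ∀ a b x → flip^ (a ℕ.+ b) x ≡ flip^ a (flip^ b x)
flip^-+ zero b x = refl
flip^-+ (suc a) b x = cong flip (flip^-+ a b x)

flip^-flip : ∀ n x → flip^ n (flip x) ≡ flip (flip^ n x)
flip^-flip zero x = refl
flip^-flip (suc n) x = cong flip (flip^-flip n x)

flip^-involutive : ∀ n x → flip^ n (flip^ n x) ≡ x
flip^-involutive zero x = refl
flip^-involutive (suc n) x = begin
  flip (flip^ n (flip (flip^ n x)))   ≡⟨ cong flip (flip^-flip n (flip^ n x)) ⟩
  flip (flip (flip^ n (flip^ n x)))   ≡⟨ flip-involutive _ ⟩
  flip^ n (flip^ n x)                 ≡⟨ flip^-involutive n x ⟩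
  x                                   ∎
  where open ≡-Reasoning

flip^-odd : ∀ n x → n % 2 ≡ 1 → flip^ n x ≡ flip x
flip^-odd (suc zero) x _ = refl
flip^-odd (suc (suc n)) x odd = trans (flip-involutive (flip^ n x)) (flip^-odd n x odd)

module _ (f : ℤ → Fin 2) (f-step : ∀ x → f (x + 1ℤ) ≡ flip (f x)) where

  private
    walk⁺ : ∀ x n → f (x + + n) ≡ flip^ n (f x)
    walk⁺ x zero = cong f (ℤP.+-identityʳ x)
    walk⁺ x (suc n) = begin
      f (x + (1ℤ + + n)) ≡⟨ cong f (regroup x (+ n)) ⟩
      f (x + + n + 1ℤ)   ≡⟨ f-step (x + + n) ⟩
      flip (f (x + + n)) ≡⟨ cong flip (walk⁺ x n) ⟩
      flip^ (suc n) (f x) ∎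
      where
      open ≡-Reasoning
      regroup : ∀ x n → x + (1ℤ + n) ≡ x + n + 1ℤ
      regroup = solve-∀

  walk-ℤ : ∀ x z → f (x + z) ≡ flip^ ∣ z ∣ (f x)
  walk-ℤ x (+ n) = walk⁺ x n
  walk-ℤ x z@(-[1+ n ]) = begin
    f (x + z)                                   ≡⟨ sym (flip^-involutive (suc n) (f (x + z))) ⟩
    flip^ (suc n) (flip^ (suc n) (f (x + z)))   ≡⟨ cong (flip^ (suc n)) (sym (walk⁺ (x + z) (suc n))) ⟩
    flip^ (suc n) (f (x + z + - z))             ≡⟨ cong (λ x' → flip^ (suc n) (f x')) (sym (cancel x z)) ⟩
    flip^ (suc n) (f x)                         ∎
    where
    open ≡-Reasoning
    cancel : ∀ x z → x ≡ x + z + - z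
    cancel = solve-∀

walk : (c : ℤ^ m → Fin 2) → (∀ b i → c (b ⊕ e i) ≡ flip (c b)) →
       ∀ a w → c (a ⊕ w) ≡ flip^ ‖ w ‖₁ (c a)
walk c step [] [] = refl
walk c step (a₀ ∷ a) (z ∷ w) = begin
  c ((a₀ + z) ∷ (a ⊕ w))
    ≡⟨ walk-ℤ (λ x → c (x ∷ (a ⊕ w))) head-step a₀ z ⟩
  flip^ (∣ z ∣) (c (a₀ ∷ (a ⊕ w)))
    ≡⟨ cong (flip^ (∣ z ∣)) (walk (λ v → c (a₀ ∷ v)) tail-step a w) ⟩
  flip^ (∣ z ∣) (flip^ ‖ w ‖₁ (c (a₀ ∷ a)))
    ≡⟨ sym (flip^-+ (∣ z ∣) ‖ w ‖₁ _) ⟩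
  flip^ ‖ z ∷ w ‖₁ (c (a₀ ∷ a))
    ∎
  where
  open ≡-Reasoning
  head-step : ∀ x → c ((x + 1ℤ) ∷ (a ⊕ w)) ≡ flip (c (x ∷ (a ⊕ w)))
  head-step x =
    trans (cong (λ v → c ((x + 1ℤ) ∷ v)) (sym (⊕-identityʳ (a ⊕ w)))) (step (x ∷ (a ⊕ w)) zero)
  tail-step : ∀ b i → c (a₀ ∷ (b ⊕ e i)) ≡ flip (c (a₀ ∷ b))
  tail-step b i =
    trans (cong (λ x → c (x ∷ (b ⊕ e i))) (sym (ℤP.+-identityʳ a₀))) (step (a₀ ∷ b) (suc i))

¬colorable₂ : (y : ℤ^ m) → ‖ y ‖₁ % 2 ≡ 1 → ¬ Colorable y 2
¬colorable₂ {m} y odd (c , well-defined , proper) = flip≢ (c a) (begin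
  flip (c a)              ≡⟨ sym (flip^-odd ‖ y ‖₁ (c a) odd) ⟩
  flip^ ‖ y ‖₁ (c a)      ≡⟨ sym (walk c step a y) ⟩
  c (a ⊕ y)               ≡⟨ cong (λ v → c (a ⊕ v)) (sym (·-identityˡ y)) ⟩
  c (a ⊕ (1ℤ · y))        ≡⟨ well-defined a 1ℤ ⟩
  c a                     ∎)
  where
  open ≡-Reasoning
  a : ℤ^ m
  a = replicate m 0ℤ
  step : ∀ b i → c (b ⊕ e i) ≡ flip (c b)
  step b i = ≢⇒≡flip (λ same → proper (b ⊕ e i) b (adjacent-e y b i) (sym same))

‖‖₁%2≡countOdd%2 : (y : ℤ^ m) → ‖ y ‖₁ % 2 ≡ countOdd y % 2
‖‖₁%2≡countOdd%2 [] = refl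
‖‖₁%2≡countOdd%2 (z ∷ v) with ∣ z ∣ % 2 in z%2 | m%n<n ∣ z ∣ 2
... | 0 | _ = begin
    (∣ z ∣ ℕ.+ ‖ v ‖₁) % 2          ≡⟨ %-distribˡ-+ ∣ z ∣ ‖ v ‖₁ 2 ⟩
    (∣ z ∣ % 2 ℕ.+ ‖ v ‖₁ % 2) % 2  ≡⟨ cong (λ r → (r ℕ.+ ‖ v ‖₁ % 2) % 2) z%2 ⟩
    ‖ v ‖₁ % 2 % 2                  ≡⟨ m%n%n≡m%n ‖ v ‖₁ 2 ⟩
    ‖ v ‖₁ % 2                      ≡⟨ ‖‖₁%2≡countOdd%2 v ⟩
    countOdd v % 2                  ∎
  where open ≡-Reasoning
... | 1 | _ = begin
    (∣ z ∣ ℕ.+ ‖ v ‖₁) % 2          ≡⟨ %-distribˡ-+ ∣ z ∣ ‖ v ‖₁ 2 ⟩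
    (∣ z ∣ % 2 ℕ.+ ‖ v ‖₁ % 2) % 2  ≡⟨ cong (λ r → (r ℕ.+ ‖ v ‖₁ % 2) % 2) z%2 ⟩
    (1 ℕ.+ ‖ v ‖₁ % 2) % 2          ≡⟨ cong (λ r → (1 ℕ.+ r) % 2) (‖‖₁%2≡countOdd%2 v) ⟩
    (1 ℕ.+ countOdd v % 2) % 2      ≡⟨ sym (%-distribˡ-+ 1 (countOdd v) 2) ⟩
    suc (countOdd v) % 2            ∎
  where open ≡-Reasoning
... | suc (suc _) | s≤s (s≤s ())

‖‖₁≡0⇒≡0 : (v : ℤ^ m) → ‖ v ‖₁ ≡ 0 → v ≡ replicate m 0ℤ
‖‖₁≡0⇒≡0 [] _ = refl
‖‖₁≡0⇒≡0 (z ∷ v) eq =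
  cong₂ _∷_ (ℤP.∣i∣≡0⇒i≡0 (ℕP.m+n≡0⇒m≡0 ∣ z ∣ eq))
            (‖‖₁≡0⇒≡0 v (ℕP.m+n≡0⇒n≡0 ∣ z ∣ eq))

neg-zero : ∀ m → neg (replicate m 0ℤ) ≡ replicate m 0ℤ
neg-zero zero = refl
neg-zero (suc m) = cong (0ℤ ∷_) (neg-zero m)

‖‖₁≡1⇒±basis : (y : ℤ^ m) → ‖ y ‖₁ ≡ 1 → IsPlusMinusBasis y
‖‖₁≡1⇒±basis (+ zero ∷ v) eq with ‖‖₁≡1⇒±basis v eq
... | j , inj₁ v≡e = suc j , inj₁ (cong (0ℤ ∷_) v≡e)
... | j , inj₂ v≡-e = suc j , inj₂ (cong (0ℤ ∷_) v≡-e)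
‖‖₁≡1⇒±basis (+ suc zero ∷ v) eq =
  zero , inj₁ (cong (1ℤ ∷_) (‖‖₁≡0⇒≡0 v (ℕP.suc-injective eq)))
‖‖₁≡1⇒±basis {suc m} (-[1+ zero ] ∷ v) eq =
  zero , inj₂ (cong (-1ℤ ∷_) (trans (‖‖₁≡0⇒≡0 v (ℕP.suc-injective eq)) (sym (neg-zero m))))

odd-non±basis⇒2≤‖‖₁ : (y : ℤ^ m) → ¬ IsPlusMinusBasis y → ‖ y ‖₁ % 2 ≡ 1 → 2 ≤ ‖ y ‖₁
odd-non±basis⇒2≤‖‖₁ y not± odd with ‖ y ‖₁ in ‖y‖₁≡
odd-non±basis⇒2≤‖‖₁ y not± () | zero
... | suc zero = ⊥-elim (not± (‖‖₁≡1⇒±basis y ‖y‖₁≡))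
... | suc (suc _) = s≤s (s≤s z≤n)

theorem2p15 : (m : ℕ) → 1 ≤ m → (y : ℤ^ m) →
    (IsPlusMinusBasis y → HasLoop y × ((k : ℕ) → ¬ Colorable y k))
    × (¬ IsPlusMinusBasis y →
        (countOdd y % 2 ≡ 0 → ChromaticNumber y 2)
        × (countOdd y % 2 ≡ 1 → ChromaticNumber y 3))
theorem2p15 (suc m) _ y =
  (λ ±basis → let loop = ±basis⇒loop y ±basis in loop , λ k → loop⇒¬colorable y loop) ,
  λ not± → (λ even → chromaticNumber y (colorable₂ y (even⇒ even)) (¬colorable₁ y)) ,
           (λ odd → chromaticNumber y (colorable₃ y (odd-non±basis⇒2≤‖‖₁ y not± (odd⇒ odd)))
                                      (¬colorable₂ y (odd⇒ odd)))
  where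
  even⇒ : countOdd y % 2 ≡ 0 → ‖ y ‖₁ % 2 ≡ 0
  even⇒ = trans (‖‖₁%2≡countOdd%2 y)
  odd⇒ : countOdd y % 2 ≡ 1 → ‖ y ‖₁ % 2 ≡ 1
  odd⇒ = trans (‖‖₁%2≡countOdd%2 y)
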